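{- For all $u,v\in\mathbb{Q}\langle e_{0},e_{1}\rangle$ and $a\in\{0,1\}$, we have $(u\sqcup\!\sqcup v)e_{a}-ue_{a}\epsilon(v)\in\mathfrak{h}\sqcup\!\sqcup\mathfrak{h}$.
   Context: $\mathfrak{h}=e_{0}\mathbb{Q}\langle e_{0},e_{1}\rangle\oplus e_{1}\mathbb{Q}\langle e_{0},e_{1}\rangle$, and $\mathfrak{h}\sqcup\!\sqcup\mathfrak{h}$ is the subspace of $\mathfrak{h}$ spanned by $\{u\sqcup\!\sqcup v\mid u,v\in\mathfrak{h}\}$. The shuffle product is defined by $u\sqcup\!\sqcup1=1\sqcup\!\sqcup u=u$, $e_{a}u\sqcup\!\sqcup e_{b}u'=e_{a}(u\sqcup\!\sqcup e_{b}u')+e_{b}(e_{a}u\sqcup\!\sqcup u')$. $\epsilon$ is the anti-automorphism of $\mathbb{Q}\langle e_0,e_1\rangle$ with $\epsilon(e_{0})=-e_{0}$, $\epsilon(e_{1})=-e_{1}$. -}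

module Defs where

open import Data.Bool using (Bool; true; false)
open import Data.Bool.Properties using () renaming (_≟_ to _≟ᴮ_)
open import Data.List using (List; []; _∷_; _++_; map; concatMap; reverse; length)
open import Data.List.Properties using (≡-dec)
open import Data.Product using (_×_; _,_; Σ; ∃)
open import Data.List.Relation.Unary.All using (All)
open import Data.Nat using (ℕ)
open import Data.Rational using (ℚ; 0ℚ; 1ℚ; _+_; _*_; -_)
open import Relation.Nullary using (yes; no)
open import Relation.Binary.PropositionalEquality using (_≡_)

Letter : Set
Letter = Bool

e₀ e₁ : Letter
e₀ = false
e₁ = true

Word : Set
Word = List Letter

-- An element of ℚ⟨e₀,e₁⟩ as a finite formal ℚ-linear combination of words.
Poly : Set
Poly = List (ℚ × Word)

coeff : Poly → Word → ℚ
coeff [] x = 0ℚ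
coeff ((c , w) ∷ p) x with ≡-dec _≟ᴮ_ w x
... | yes _ = c + coeff p x
... | no  _ = coeff p x

_≈_ : Poly → Poly → Set
p ≈ q = ∀ x → coeff p x ≡ coeff q x

infix 4 _≈_

_◃_ : Letter → Poly → Poly
a ◃ p = map (λ { (c , w) → (c , a ∷ w) }) p

scale : ℚ → Poly → Poly
scale k p = map (λ { (c , w) → (k * c , w) }) p

neg : Poly → Poly
neg = scale (- 1ℚ)

_⊖_ : Poly → Poly → Poly
p ⊖ q = p ++ neg q

shW : Word → Word → Poly
shW [] v = (1ℚ , v) ∷ []
shW (a ∷ u) [] = (1ℚ , a ∷ u) ∷ []
shW (a ∷ u) (b ∷ v) = (a ◃ shW u (b ∷ v)) ++ (b ◃ shW (a ∷ u) v)

_⧢_ : Poly → Poly → Poly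
p ⧢ q = concatMap (λ { (c , u) → concatMap (λ { (d , v) → scale (c * d) (shW u v) }) q }) p

_·_ : Poly → Poly → Poly
p · q = concatMap (λ { (c , u) → map (λ { (d , v) → (c * d , u ++ v) }) q }) p

letter : Letter → Poly
letter a = (1ℚ , a ∷ []) ∷ []

sign : ℕ → ℚ
sign ℕ.zero = 1ℚ
sign (ℕ.suc n) = - sign n

-- ε : anti-automorphism with ε(e₀) = -e₀, ε(e₁) = -e₁,
-- so ε(w) = (-1)^|w| · reverse w on words, extended linearly
ε : Poly → Poly
ε p = map (λ { (c , w) → (sign (length w) * c , reverse w) }) p

-- 𝔥 = e₀ℚ⟨e₀,e₁⟩ ⊕ e₁ℚ⟨e₀,e₁⟩ : polynomials with zero constant term
In𝔥 : Poly → Set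
In𝔥 p = coeff p [] ≡ 0ℚ

-- 𝔥 ⧢ 𝔥 : the ℚ-span of { u ⧢ v | u, v ∈ 𝔥 }.
-- (Scalars are absorbed into u, so a finite sum Σ uᵢ ⧢ vᵢ suffices.)
sumSh : List (Poly × Poly) → Poly
sumSh [] = []
sumSh ((u , v) ∷ l) = (u ⧢ v) ++ sumSh l

In𝔥⧢𝔥 : Poly → Set
In𝔥⧢𝔥 p = Σ (List (Poly × Poly)) λ l →
  All (λ { (u , v) → In𝔥 u × In𝔥 v }) l × (p ≈ sumSh l)

module Submission where

-- Proof idea.  For words w, v consider the "twisted deconcatenation"
--
--     K(w, v) = Σ_{v = x y} (-1)^{|y|} (w · rev y) ⧢ x .
--
-- (1) K obeys the shuffle recursion: K(c w, b v) = c K(w, b v) + b K(c w, v).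
-- (2) Antipode identity: if K(c, w) = w c then K(∅, w c) = 0.
-- (3) From (1) and (2), by induction on |v|, K(a, v) = v a; then from (1),
--     by induction on u and v, K(u a, v) = (u ⧢ v) a, the key identity.
-- In K(u a, v) the cut x = ∅ contributes (-1)^{|v|} u a rev(v) = u a ε(v);
-- every other cut contributes (u a rev y) ⧢ x with both factors nonempty
-- words, i.e. an element of 𝔥 ⧢ 𝔥.  Extending bilinearly over the monomials
-- of u and v gives an explicit list of pairs witnessing the theorem.

open import Defs
open import Data.Bool.Properties using () renaming (_≟_ to _≟ᴮ_)
open import Data.List using (List; []; _∷_; _++_; map; concatMap; reverse; length)
open import Data.List.Properties
  using (≡-dec; map-++; ++-assoc; ++-identityʳ; reverse-++; map-∘; length-++;
         concatMap-++; concatMap-cong; concatMap-map; map-concatMap; concatMap-pure)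
open import Data.List.Relation.Unary.All using (All; []; _∷_)
open import Data.List.Relation.Unary.All.Properties using (++⁺)
open import Data.Nat using (suc; zero)
import Data.Nat.Properties as ℕP
open import Data.Product using (_×_; _,_; Σ; proj₁; proj₂)
open import Data.Rational using (ℚ; 0ℚ; 1ℚ; _+_; _*_; -_)
import Data.Rational.Properties as ℚP
open import Data.Rational.Solver using (module +-*-Solver)
open import Level using (0ℓ)
open import Relation.Binary.Bundles using (Setoid)
import Relation.Binary.Reasoning.Setoid
open import Relation.Binary.PropositionalEquality
open import Relation.Nullary using (yes; no; ¬_; contradiction)

open +-*-Solver using (solve; _:+_; _:*_; :-_; _:=_; con)

coeff-++ : ∀ p q x → coeff (p ++ q) x ≡ coeff p x + coeff q x
coeff-++ [] q x = sym (ℚP.+-identityˡ (coeff q x))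
coeff-++ ((c , w) ∷ p) q x with ≡-dec _≟ᴮ_ w x
... | yes _ = trans (cong (c +_) (coeff-++ p q x)) (sym (ℚP.+-assoc c (coeff p x) (coeff q x)))
... | no _ = coeff-++ p q x

coeff-scale : ∀ k p x → coeff (scale k p) x ≡ k * coeff p x
coeff-scale k [] x = sym (ℚP.*-zeroʳ k)
coeff-scale k ((c , w) ∷ p) x with ≡-dec _≟ᴮ_ w x
... | yes _ = trans (cong (k * c +_) (coeff-scale k p x)) (sym (ℚP.*-distribˡ-+ k c (coeff p x)))
... | no _ = coeff-scale k p x

coeff-hit : ∀ c w p x → w ≡ x → coeff ((c , w) ∷ p) x ≡ c + coeff p x
coeff-hit c w p x w≡x with ≡-dec _≟ᴮ_ w x
... | yes _ = refl
... | no w≢x = contradiction w≡x w≢x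

coeff-miss : ∀ c w p x → ¬ w ≡ x → coeff ((c , w) ∷ p) x ≡ coeff p x
coeff-miss c w p x w≢x with ≡-dec _≟ᴮ_ w x
... | yes w≡x = contradiction w≡x w≢x
... | no _ = refl

-- Case distinction on equality of words, without abstracting the goal.
word-cases : ∀ {P : Set} (w x : Word) → (w ≡ x → P) → (¬ w ≡ x → P) → P
word-cases w x hit miss with ≡-dec _≟ᴮ_ w x
... | yes w≡x = hit w≡x
... | no w≢x = miss w≢x

coeff-◃-[] : ∀ a p → coeff (a ◃ p) [] ≡ 0ℚ
coeff-◃-[] a [] = refl
coeff-◃-[] a ((c , w) ∷ p) = trans (coeff-miss c (a ∷ w) (a ◃ p) [] (λ ())) (coeff-◃-[] a p)

coeff-◃-same : ∀ a p x → coeff (a ◃ p) (a ∷ x) ≡ coeff p x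
coeff-◃-same a [] x = refl
coeff-◃-same a ((c , w) ∷ p) x = word-cases w x
  (λ w≡x → trans (coeff-hit c (a ∷ w) (a ◃ p) (a ∷ x) (cong (a ∷_) w≡x))
             (trans (cong (c +_) (coeff-◃-same a p x)) (sym (coeff-hit c w p x w≡x))))
  (λ w≢x → trans (coeff-miss c (a ∷ w) (a ◃ p) (a ∷ x) (λ { refl → w≢x refl }))
             (trans (coeff-◃-same a p x) (sym (coeff-miss c w p x w≢x))))

coeff-◃-other : ∀ a b p x → ¬ a ≡ b → coeff (a ◃ p) (b ∷ x) ≡ 0ℚ
coeff-◃-other a b [] x _ = refl
coeff-◃-other a b ((c , w) ∷ p) x a≢b =
  trans (coeff-miss c (a ∷ w) (a ◃ p) (b ∷ x) (λ { refl → a≢b refl })) (coeff-◃-other a b p x a≢b)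

-- The setoid of polynomials up to equality of all coefficients.
-- (_≈_ is wrapped in a record so that both polynomials can be inferred.)

infix 4 _≋_
record _≋_ (p q : Poly) : Set where
  constructor mk≋
  field coeff-≡ : p ≈ q
open _≋_ public

≋-setoid : Setoid 0ℓ 0ℓ
≋-setoid = record
  { Carrier = Poly
  ; _≈_ = _≋_
  ; isEquivalence = record
    { refl = mk≋ (λ _ → refl)
    ; sym = λ (mk≋ e) → mk≋ (λ x → sym (e x))
    ; trans = λ (mk≋ e) (mk≋ f) → mk≋ (λ x → trans (e x) (f x))
    }
  }

open Setoid ≋-setoid using () renaming (refl to ≋-refl; sym to ≋-sym; trans to ≋-trans)
module ≋-Reasoning = Relation.Binary.Reasoning.Setoid ≋-setoid

++-cong : ∀ {p p' q q'} → p ≋ p' → q ≋ q' → p ++ q ≋ p' ++ q'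
++-cong {p} {p'} {q} {q'} (mk≋ e) (mk≋ f) =
  mk≋ (λ x → trans (coeff-++ p q x) (trans (cong₂ _+_ (e x) (f x)) (sym (coeff-++ p' q' x))))

scale-cong : ∀ k {p q} → p ≋ q → scale k p ≋ scale k q
scale-cong k {p} {q} (mk≋ e) =
  mk≋ (λ x → trans (coeff-scale k p x) (trans (cong (k *_) (e x)) (sym (coeff-scale k q x))))

◃-cong : ∀ a {p q} → p ≋ q → a ◃ p ≋ a ◃ q
◃-cong a {p} {q} (mk≋ e) = mk≋ same
  where
  same : ∀ x → coeff (a ◃ p) x ≡ coeff (a ◃ q) x
  same [] = trans (coeff-◃-[] a p) (sym (coeff-◃-[] a q))
  same (b ∷ x) with a ≟ᴮ b
  ... | yes refl = trans (coeff-◃-same a p x) (trans (e x) (sym (coeff-◃-same a q x)))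
  ... | no a≢b = trans (coeff-◃-other a b p x a≢b) (sym (coeff-◃-other a b q x a≢b))

concatMap-cong≋ : ∀ {A : Set} {f g : A → Poly} l → (∀ t → f t ≋ g t) → concatMap f l ≋ concatMap g l
concatMap-cong≋ [] e = ≋-refl
concatMap-cong≋ (t ∷ l) e = ++-cong (e t) (concatMap-cong≋ l e)

concatMap-++-distrib : ∀ {A : Set} (f g : A → Poly) l →
  concatMap (λ t → f t ++ g t) l ≋ concatMap f l ++ concatMap g l
concatMap-++-distrib f g [] = ≋-refl
concatMap-++-distrib f g (t ∷ l) = ≋-trans (++-cong ≋-refl (concatMap-++-distrib f g l)) (mk≋ swap)
  where
  interchange : ∀ a b c d → (a + b) + (c + d) ≡ (a + c) + (b + d)
  interchange = solve 4 (λ a b c d → (a :+ b) :+ (c :+ d) := (a :+ c) :+ (b :+ d)) refl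
  swap : ∀ x → coeff ((f t ++ g t) ++ (concatMap f l ++ concatMap g l)) x
             ≡ coeff ((f t ++ concatMap f l) ++ (g t ++ concatMap g l)) x
  swap x rewrite coeff-++ (f t ++ g t) (concatMap f l ++ concatMap g l) x
               | coeff-++ (f t ++ concatMap f l) (g t ++ concatMap g l) x
               | coeff-++ (f t) (g t) x | coeff-++ (concatMap f l) (concatMap g l) x
               | coeff-++ (f t) (concatMap f l) x | coeff-++ (g t) (concatMap g l) x
    = interchange (coeff (f t) x) (coeff (g t) x) (coeff (concatMap f l) x) (coeff (concatMap g l) x)

double-sum-++ : ∀ {A B : Set} (f g : A → B → Poly) (l : List A) (m : List B) →
  concatMap (λ t → concatMap (λ s → f t s ++ g t s) m) l
    ≋ concatMap (λ t → concatMap (f t) m) l ++ concatMap (λ t → concatMap (g t) m) l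
double-sum-++ f g l m =
  ≋-trans (concatMap-cong≋ l (λ t → concatMap-++-distrib (f t) (g t) m)) (concatMap-++-distrib _ _ l)

++-⊖-cancel : ∀ q p → (q ++ p) ⊖ q ≋ p
++-⊖-cancel q p = mk≋ λ x →
  begin
    coeff ((q ++ p) ++ neg q) x
  ≡⟨ coeff-++ (q ++ p) (neg q) x ⟩
    coeff (q ++ p) x + coeff (neg q) x
  ≡⟨ cong₂ _+_ (coeff-++ q p x) (coeff-scale (- 1ℚ) q x) ⟩
    (coeff q x + coeff p x) + (- 1ℚ) * coeff q x
  ≡⟨ solve 2 (λ a b → (a :+ b) :+ (:- con 1ℚ) :* a := b) refl (coeff q x) (coeff p x) ⟩
    coeff p x
  ∎
  where open ≡-Reasoning

neg-++-cancel : ∀ q → neg q ++ q ≋ []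
neg-++-cancel q = mk≋ λ x →
  trans (coeff-++ (neg q) q x)
  (trans (cong (_+ coeff q x) (coeff-scale (- 1ℚ) q x))
         (solve 1 (λ a → (:- con 1ℚ) :* a :+ a := con 0ℚ) refl (coeff q x)))

neg-scale : ∀ s p → scale (- s) p ≋ neg (scale s p)
neg-scale s p = mk≋ λ x →
  trans (coeff-scale (- s) p x)
  (trans (solve 2 (λ s e → (:- s) :* e := (:- con 1ℚ) :* (s :* e)) refl s (coeff p x))
  (sym (trans (coeff-scale (- 1ℚ) (scale s p) x) (cong ((- 1ℚ) *_) (coeff-scale s p x)))))

concatMap-concatMap : ∀ {A B C : Set} (g : B → List C) (f : A → List B) l →
  concatMap g (concatMap f l) ≡ concatMap (λ t → concatMap g (f t)) l
concatMap-concatMap g f [] = refl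
concatMap-concatMap g f (t ∷ l) =
  trans (concatMap-++ g (f t) (concatMap f l)) (cong (concatMap g (f t) ++_) (concatMap-concatMap g f l))

scale-◃ : ∀ k a p → scale k (a ◃ p) ≡ a ◃ scale k p
scale-◃ k a [] = refl
scale-◃ k a ((c , w) ∷ p) = cong ((k * c , a ∷ w) ∷_) (scale-◃ k a p)

◃-· : ∀ c p a → (c ◃ p) · letter a ≡ c ◃ (p · letter a)
◃-· c [] a = refl
◃-· c ((k , w) ∷ p) a = cong ((k * 1ℚ , c ∷ (w ++ a ∷ [])) ∷_) (◃-· c p a)

scale-· : ∀ k p a → scale k p · letter a ≡ scale k (p · letter a)
scale-· k [] a = refl
scale-· k ((e , w) ∷ p) a = cong₂ _∷_ (cong (_, w ++ a ∷ []) (ℚP.*-assoc k e 1ℚ)) (scale-· k p a)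

shW-[] : ∀ z → shW z [] ≡ (1ℚ , z) ∷ []
shW-[] [] = refl
shW-[] (a ∷ z) = refl

sgn : Word → ℚ
sgn w = sign (length w)

consˡ : Letter → Word × Word → Word × Word
consˡ b (x , y) = (b ∷ x , y)

snocʳ : Letter → Word × Word → Word × Word
snocʳ c (x , y) = (x , y ++ c ∷ [])

mutual
  cuts : Word → List (Word × Word)
  cuts v = ([] , v) ∷ cuts⁺ v

  cuts⁺ : Word → List (Word × Word)
  cuts⁺ [] = []
  cuts⁺ (b ∷ v) = map (consˡ b) (cuts v)

twist : Word → Word × Word → Poly
twist w (x , y) = scale (sgn y) (shW (w ++ reverse y) x)

K K⁺ : Word → Word → Poly
K w v = concatMap (twist w) (cuts v)
K⁺ w v = concatMap (twist w) (cuts⁺ v)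

twist-consˡ : ∀ c w b t →
  twist (c ∷ w) (consˡ b t) ≡ (c ◃ twist w (consˡ b t)) ++ (b ◃ twist (c ∷ w) t)
twist-consˡ c w b (x , y) =
  trans (map-++ _ (c ◃ shW (w ++ reverse y) (b ∷ x)) (b ◃ shW (c ∷ (w ++ reverse y)) x))
        (cong₂ _++_ (scale-◃ (sgn y) c (shW (w ++ reverse y) (b ∷ x)))
                    (scale-◃ (sgn y) b (shW (c ∷ (w ++ reverse y)) x)))

twist-empty : ∀ c w v → twist (c ∷ w) ([] , v) ≡ c ◃ twist w ([] , v)
twist-empty c w v rewrite shW-[] (c ∷ (w ++ reverse v)) | shW-[] (w ++ reverse v) = refl

K-shuffle-rec : ∀ c w b v → K (c ∷ w) (b ∷ v) ≋ (c ◃ K w (b ∷ v)) ++ (b ◃ K (c ∷ w) v)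
K-shuffle-rec c w b v =
  begin
    K (c ∷ w) (b ∷ v)
  ≡⟨⟩
    H ++ concatMap (twist (c ∷ w)) (map (consˡ b) (cuts v))
  ≡⟨ cong (H ++_) (trans (concatMap-map (twist (c ∷ w)) (consˡ b) (cuts v))
                         (concatMap-cong (twist-consˡ c w b) (cuts v))) ⟩
    H ++ concatMap (λ t → (c ◃ twist w (consˡ b t)) ++ (b ◃ twist (c ∷ w) t)) (cuts v)
  ≈⟨ ++-cong (≋-refl {H}) (concatMap-++-distrib (λ t → c ◃ twist w (consˡ b t)) (λ t → b ◃ twist (c ∷ w) t) (cuts v)) ⟩
    H ++ (concatMap (λ t → c ◃ twist w (consˡ b t)) (cuts v) ++ concatMap (λ t → b ◃ twist (c ∷ w) t) (cuts v))
  ≡⟨ cong₂ (λ P Q → H ++ (P ++ Q))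
       (trans (sym (map-concatMap _ (λ t → twist w (consˡ b t)) (cuts v)))
              (cong (c ◃_) (sym (concatMap-map (twist w) (consˡ b) (cuts v)))))
       (sym (map-concatMap _ (twist (c ∷ w)) (cuts v))) ⟩
    H ++ ((c ◃ K⁺ w (b ∷ v)) ++ (b ◃ K (c ∷ w) v))
  ≡⟨ trans (cong (_++ R) (twist-empty c w (b ∷ v))) (sym (++-assoc (c ◃ twist w ([] , b ∷ v)) (c ◃ K⁺ w (b ∷ v)) (b ◃ K (c ∷ w) v))) ⟩
    ((c ◃ twist w ([] , b ∷ v)) ++ (c ◃ K⁺ w (b ∷ v))) ++ (b ◃ K (c ∷ w) v)
  ≡⟨ cong (_++ (b ◃ K (c ∷ w) v)) (sym (map-++ _ (twist w ([] , b ∷ v)) (K⁺ w (b ∷ v)))) ⟩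
    (c ◃ K w (b ∷ v)) ++ (b ◃ K (c ∷ w) v)
  ∎
  where
  open ≋-Reasoning
  H = twist (c ∷ w) ([] , b ∷ v)
  R = (c ◃ K⁺ w (b ∷ v)) ++ (b ◃ K (c ∷ w) v)

cuts-snoc : ∀ w c → cuts (w ++ c ∷ []) ≡ map (snocʳ c) (cuts w) ++ (w ++ c ∷ [] , []) ∷ []
cuts-snoc [] c = refl
cuts-snoc (b ∷ w) c = cong (([] , b ∷ (w ++ c ∷ [])) ∷_)
  (trans (cong (map (consˡ b)) (cuts-snoc w c))
  (trans (map-++ (consˡ b) (map (snocʳ c) (cuts w)) ((w ++ c ∷ [] , []) ∷ []))
  (cong (_++ ((b ∷ (w ++ c ∷ []) , []) ∷ []))
    (trans (sym (map-∘ (cuts w))) (map-∘ (cuts w))))))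

twist-snocʳ : ∀ c t → twist [] (snocʳ c t) ≋ neg (twist (c ∷ []) t)
twist-snocʳ c (x , y)
  rewrite reverse-++ y (c ∷ []) | length-++ y {c ∷ []} | ℕP.+-comm (length y) 1
  = neg-scale (sgn y) (shW (c ∷ reverse y) x)

antipode : ∀ w c → K (c ∷ []) w ≋ shW [] w · letter c → K [] (w ++ c ∷ []) ≋ []
antipode w c K-c =
  begin
    K [] (w ++ c ∷ [])
  ≡⟨ trans (cong (concatMap (twist [])) (cuts-snoc w c))
     (trans (concatMap-++ (twist []) (map (snocʳ c) (cuts w)) ((w ++ c ∷ [] , []) ∷ []))
            (cong (_++ T) (concatMap-map (twist []) (snocʳ c) (cuts w)))) ⟩
    concatMap (λ t → twist [] (snocʳ c t)) (cuts w) ++ T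
  ≈⟨ ++-cong (concatMap-cong≋ (cuts w) (twist-snocʳ c)) ≋-refl ⟩
    concatMap (λ t → neg (twist (c ∷ []) t)) (cuts w) ++ T
  ≡⟨ cong (_++ T) (sym (map-concatMap _ (twist (c ∷ [])) (cuts w))) ⟩
    neg (K (c ∷ []) w) ++ T
  ≈⟨ ++-cong (scale-cong (- 1ℚ) K-c) ≋-refl ⟩
    neg ((1ℚ * 1ℚ , w ++ c ∷ []) ∷ []) ++ T
  ≈⟨ neg-++-cancel ((1ℚ * 1ℚ , w ++ c ∷ []) ∷ []) ⟩
    []
  ∎
  where
  open ≋-Reasoning
  T = twist [] (w ++ c ∷ [] , [])

split-last : ∀ (b : Letter) v → Σ Word λ w → Σ Letter λ c → (b ∷ v ≡ w ++ c ∷ []) × (length w ≡ length v)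
split-last b [] = [] , b , refl , refl
split-last b (b' ∷ v) with split-last b' v
... | w , c , e , l = b ∷ w , c , cong (b ∷_) e , cong suc l

-- K(a, v) = v a, by induction on |v|, using the antipode identity for words of length |v|.
K-letter : ∀ n v → length v ≡ n → ∀ a → K (a ∷ []) v ≋ shW [] v · letter a
K-letter n [] _ a = ≋-refl
K-letter zero (b ∷ v) () a
K-letter (suc n) (b ∷ v) |bv|≡ a =
  begin
    K (a ∷ []) (b ∷ v)
  ≈⟨ K-shuffle-rec a [] b v ⟩
    (a ◃ K [] (b ∷ v)) ++ (b ◃ K (a ∷ []) v)
  ≈⟨ ++-cong (◃-cong a vanish) (◃-cong b (K-letter n v |v|≡ a)) ⟩
    shW [] (b ∷ v) · letter a
  ∎
  where
  open ≋-Reasoning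
  |v|≡ : length v ≡ n
  |v|≡ = ℕP.suc-injective |bv|≡
  vanish : K [] (b ∷ v) ≋ []
  vanish with split-last b v
  ... | w , c , bv≡wc , |w|≡|v| =
    subst (λ z → K [] z ≋ []) (sym bv≡wc) (antipode w c (K-letter n w (trans |w|≡|v| |v|≡) c))

-- Both sides obey the shuffle recursion, so they agree.
K-key : ∀ u v a → K (u ++ a ∷ []) v ≋ shW u v · letter a
K-key [] v a = K-letter (length v) v refl a
K-key (c ∷ u) [] a rewrite shW-[] (c ∷ (u ++ a ∷ [])) | ++-identityʳ (u ++ a ∷ []) = ≋-refl
K-key (c ∷ u) (b ∷ v) a =
  begin
    K (c ∷ (u ++ a ∷ [])) (b ∷ v)
  ≈⟨ K-shuffle-rec c (u ++ a ∷ []) b v ⟩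
    (c ◃ K (u ++ a ∷ []) (b ∷ v)) ++ (b ◃ K (c ∷ (u ++ a ∷ [])) v)
  ≈⟨ ++-cong (◃-cong c (K-key u (b ∷ v) a)) (◃-cong b (K-key (c ∷ u) v a)) ⟩
    (c ◃ (shW u (b ∷ v) · letter a)) ++ (b ◃ (shW (c ∷ u) v · letter a))
  ≡⟨ sym (trans (concatMap-++ _ (c ◃ shW u (b ∷ v)) (b ◃ shW (c ∷ u) v))
                (cong₂ _++_ (◃-· c (shW u (b ∷ v)) a) (◃-· b (shW (c ∷ u) v) a))) ⟩
    shW (c ∷ u) (b ∷ v) · letter a
  ∎
  where open ≋-Reasoning

sumSh-++ : ∀ l₁ l₂ → sumSh (l₁ ++ l₂) ≡ sumSh l₁ ++ sumSh l₂
sumSh-++ [] l₂ = refl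
sumSh-++ ((p , q) ∷ l₁) l₂ = trans (cong ((p ⧢ q) ++_) (sumSh-++ l₁ l₂)) (sym (++-assoc (p ⧢ q) _ _))

sumSh-concatMap : ∀ {A : Set} (f : A → List (Poly × Poly)) l →
  sumSh (concatMap f l) ≡ concatMap (λ t → sumSh (f t)) l
sumSh-concatMap f [] = refl
sumSh-concatMap f (t ∷ l) = trans (sumSh-++ (f t) (concatMap f l)) (cong (sumSh (f t) ++_) (sumSh-concatMap f l))

sumSh-map : ∀ {A : Set} (f : A → Poly × Poly) l →
  sumSh (map f l) ≡ concatMap (λ z → proj₁ (f z) ⧢ proj₂ (f z)) l
sumSh-map f [] = refl
sumSh-map f (z ∷ l) = cong ((proj₁ (f z) ⧢ proj₂ (f z)) ++_) (sumSh-map f l)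

cutPair : ℚ → Word → Word × Word → Poly × Poly
cutPair k W (x , y) = ((k * sgn y , W ++ reverse y) ∷ [] , (1ℚ , x) ∷ [])

twist-as-shuffle : ∀ k W z → scale k (twist W z) ≋ proj₁ (cutPair k W z) ⧢ proj₂ (cutPair k W z)
twist-as-shuffle k W (x , y) = mk≋ λ x' →
  begin
    coeff (scale k (scale (sgn y) P)) x'
  ≡⟨ trans (coeff-scale k (scale (sgn y) P) x') (cong (k *_) (coeff-scale (sgn y) P x')) ⟩
    k * (sgn y * coeff P x')
  ≡⟨ solve 3 (λ k s e → k :* (s :* e) := ((k :* s) :* con 1ℚ) :* e) refl k (sgn y) (coeff P x') ⟩
    ((k * sgn y) * 1ℚ) * coeff P x'
  ≡⟨ sym (coeff-scale ((k * sgn y) * 1ℚ) P x') ⟩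
    coeff (scale ((k * sgn y) * 1ℚ) P) x'
  ≡⟨ cong (λ q → coeff q x') (sym (trans (++-identityʳ (scale ((k * sgn y) * 1ℚ) P ++ [])) (++-identityʳ (scale ((k * sgn y) * 1ℚ) P)))) ⟩
    coeff (((k * sgn y , W ++ reverse y) ∷ []) ⧢ ((1ℚ , x) ∷ [])) x'
  ∎
  where
  open ≡-Reasoning
  P = shW (W ++ reverse y) x

word-decomposition : ∀ k uw vw a →
  scale k (shW uw vw · letter a)
    ≋ ((k * sgn vw , (uw ++ a ∷ []) ++ reverse vw) ∷ []) ++ sumSh (map (cutPair k (uw ++ a ∷ [])) (cuts⁺ vw))
word-decomposition k uw vw a =
  begin
    scale k (shW uw vw · letter a)
  ≈⟨ scale-cong k (≋-sym (K-key uw vw a)) ⟩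
    scale k (K W vw)
  ≡⟨ map-++ _ (twist W ([] , vw)) (K⁺ W vw) ⟩
    scale k (twist W ([] , vw)) ++ scale k (K⁺ W vw)
  ≡⟨ cong₂ _++_ leading (map-concatMap _ (twist W) (cuts⁺ vw)) ⟩
    ((k * sgn vw , W ++ reverse vw) ∷ []) ++ concatMap (λ z → scale k (twist W z)) (cuts⁺ vw)
  ≈⟨ ++-cong ≋-refl (concatMap-cong≋ (cuts⁺ vw) (twist-as-shuffle k W)) ⟩
    ((k * sgn vw , W ++ reverse vw) ∷ []) ++ concatMap (λ z → proj₁ (cutPair k W z) ⧢ proj₂ (cutPair k W z)) (cuts⁺ vw)
  ≡⟨ cong (((k * sgn vw , W ++ reverse vw) ∷ []) ++_) (sym (sumSh-map (cutPair k W) (cuts⁺ vw))) ⟩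
    ((k * sgn vw , W ++ reverse vw) ∷ []) ++ sumSh (map (cutPair k W) (cuts⁺ vw))
  ∎
  where
  open ≋-Reasoning
  W = uw ++ a ∷ []
  leading : scale k (twist W ([] , vw)) ≡ (k * sgn vw , W ++ reverse vw) ∷ []
  leading rewrite shW-[] (W ++ reverse vw) | ℚP.*-identityʳ (sgn vw) = refl

In𝔥-monomial : ∀ k (w : Word) → ¬ w ≡ [] → In𝔥 ((k , w) ∷ [])
In𝔥-monomial k w w≢[] = coeff-miss k w [] [] w≢[]

Good : Poly × Poly → Set
Good (p , q) = In𝔥 p × In𝔥 q

snoc-++-nonempty : ∀ (w : Word) a r → ¬ (w ++ a ∷ []) ++ r ≡ []
snoc-++-nonempty [] a r ()
snoc-++-nonempty (_ ∷ _) a r ()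

cutPairs-good : ∀ k w a vw → All Good (map (cutPair k (w ++ a ∷ [])) (cuts⁺ vw))
cutPairs-good k w a [] = []
cutPairs-good k w a (b ∷ vw) = go (cuts vw)
  where
  go : ∀ l → All Good (map (cutPair k (w ++ a ∷ [])) (map (consˡ b) l))
  go [] = []
  go ((x , y) ∷ l) =
    (In𝔥-monomial _ _ (snoc-++-nonempty w a (reverse y)) , In𝔥-monomial 1ℚ (b ∷ x) (λ ())) ∷ go l

module _ (u v : Poly) (a : Letter) where

  witnesses : ℚ × Word → ℚ × Word → List (Poly × Poly)
  witnesses (c , uw) (d , vw) = map (cutPair (c * d) (uw ++ a ∷ [])) (cuts⁺ vw)

  productTerm : ℚ × Word → ℚ × Word → ℚ × Word
  productTerm (c , uw) (d , vw) = ((c * 1ℚ) * (sgn vw * d) , (uw ++ a ∷ []) ++ reverse vw)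

  L : List (Poly × Poly)
  L = concatMap (λ t → concatMap (witnesses t) v) u

  monomial-decomposition : ∀ t s →
    scale (proj₁ t * proj₁ s) (shW (proj₂ t) (proj₂ s)) · letter a ≋ (productTerm t s ∷ []) ++ sumSh (witnesses t s)
  monomial-decomposition (c , uw) (d , vw) =
    begin
      scale (c * d) (shW uw vw) · letter a
    ≡⟨ scale-· (c * d) (shW uw vw) a ⟩
      scale (c * d) (shW uw vw · letter a)
    ≈⟨ word-decomposition (c * d) uw vw a ⟩
      (((c * d) * sgn vw , W) ∷ []) ++ S
    ≡⟨ cong (λ e → ((e , W) ∷ []) ++ S) coefficient ⟩
      (productTerm (c , uw) (d , vw) ∷ []) ++ S
    ∎
    where
    open ≋-Reasoning
    W = (uw ++ a ∷ []) ++ reverse vw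
    S = sumSh (witnesses (c , uw) (d , vw))
    coefficient : (c * d) * sgn vw ≡ (c * 1ℚ) * (sgn vw * d)
    coefficient = solve 3 (λ c d s → (c :* d) :* s := (c :* con 1ℚ) :* (s :* d)) refl c d (sgn vw)

  shuffle-expansion : (u ⧢ v) · letter a
    ≡ concatMap (λ t → concatMap (λ s → scale (proj₁ t * proj₁ s) (shW (proj₂ t) (proj₂ s)) · letter a) v) u
  shuffle-expansion = trans (concatMap-concatMap _ _ u) (concatMap-cong (λ t → concatMap-concatMap _ _ v) u)

  product-monomial : ∀ c uw → (((c , uw) ∷ []) · letter a) · ε v ≡ concatMap (λ s → productTerm (c , uw) s ∷ []) v
  product-monomial c uw = trans (++-identityʳ _)
    (trans (sym (map-∘ v)) (trans (sym (concatMap-pure (map (productTerm (c , uw)) v))) (concatMap-map _ (productTerm (c , uw)) v)))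

  product-expansion : (u · letter a) · ε v ≡ concatMap (λ t → concatMap (λ s → productTerm t s ∷ []) v) u
  product-expansion =
    trans (concatMap-concatMap _ _ u) (concatMap-cong (λ { (c , uw) → product-monomial c uw }) u)

  decomposition : ((u ⧢ v) · letter a) ⊖ ((u · letter a) · ε v) ≋ sumSh L
  decomposition =
    begin
      ((u ⧢ v) · letter a) ⊖ Y
    ≈⟨ ++-cong (≋-trans (mk≋ (λ x → cong (λ q → coeff q x) shuffle-expansion))
                        (concatMap-cong≋ u (λ t → concatMap-cong≋ v (monomial-decomposition t)))) ≋-refl ⟩
      concatMap (λ t → concatMap (λ s → (productTerm t s ∷ []) ++ sumSh (witnesses t s)) v) u ⊖ Y
    ≈⟨ ++-cong (double-sum-++ _ _ u v) ≋-refl ⟩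
      (concatMap (λ t → concatMap (λ s → productTerm t s ∷ []) v) u ++ concatMap (λ t → concatMap (λ s → sumSh (witnesses t s)) v) u) ⊖ Y
    ≡⟨ cong₂ (λ P Q → (P ++ Q) ⊖ Y) (sym product-expansion)
         (sym (trans (sumSh-concatMap _ u) (concatMap-cong (λ t → sumSh-concatMap _ v) u))) ⟩
      (Y ++ sumSh L) ⊖ Y
    ≈⟨ ++-⊖-cancel Y (sumSh L) ⟩
      sumSh L
    ∎
    where
    open ≋-Reasoning
    Y = (u · letter a) · ε v

  witnesses-good : All Good L
  witnesses-good = all-concatMap u (λ t → all-concatMap v (good t))
    where
    all-concatMap : ∀ {A : Set} {f : A → List (Poly × Poly)} l → (∀ t → All Good (f t)) → All Good (concatMap f l)
    all-concatMap [] h = []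
    all-concatMap (t ∷ l) h = ++⁺ (h t) (all-concatMap l h)
    good : ∀ t s → All Good (witnesses t s)
    good (c , uw) (d , vw) = cutPairs-good (c * d) uw a vw

lemma5p7 : (u v : Poly) (a : Letter) →
    In𝔥⧢𝔥 (((u ⧢ v) · letter a) ⊖ ((u · letter a) · ε v))
lemma5p7 u v a = L u v a , witnesses-good u v a , coeff-≡ (decomposition u v a)
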